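{- Let $\mathsf{L}^{\mathsf{A}}$ be any of the logics described in the context and $\mathsf{CS}$ any constant specification. For every formula $F$ of the purely propositional language (built from atomic propositions and $\bot$ with $\to$, no terms): $\mathsf{L}^{\mathsf{A}}_{\mathsf{CS}}\vdash F$ if and only if $\mathsf{CL}\vdash F$, where $\mathsf{CL}$ is classical propositional logic.
   Context: Terms: $t::=c_i\mid x_i\mid (t\cdot t)\mid(t+t)\mid\ !t$ ($c_i$ constants, $x_i$ variables). Formulas: $F::=p_i\mid\bot\mid F\to F\mid t:F$. Axiom schemes: (cl) all classical propositional axioms (instantiated in this language); (j) $s:(A\to B)\to(t:A\to s\cdot t:B)$; (j+) $s:A\lor t:A\to(s+t):A$; (j4) $t:A\to\ !t:(t:A)$; (jd) $t:\bot\to\bot$; (jt) $t:A\to A$. A logic $\mathsf{L}^{\mathsf{A}}$ consists of (cl),(j),(j+) and some subset of $\{$(j4),(jd),(jt)$\}$. A constant specification $\mathsf{CS}$ is a set of pairs $(c,A)$, $c$ a constant, $A$ an axiom of $\mathsf{L}^{\mathsf{A}}$. $\mathsf{L}^{\mathsf{A}}_{\mathsf{CS}}$: Hilbert system with these axioms, modus ponens and axiom necessitation (for $(c,A)\in\mathsf{CS}$, $n\ge0$ infer $!^nc:\,!^{n-1}c:\cdots:\,!c:c:A$). -}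

module Defs where

open import Data.Nat using (ℕ; zero; suc)
open import Data.Bool using (Bool; true)
open import Relation.Binary.PropositionalEquality using (_≡_)

data Term : Set where
  const : ℕ → Term
  var   : ℕ → Term
  _·_   : Term → Term → Term
  _⊕_   : Term → Term → Term
  !_    : Term → Term

infixr 5 _⇒_
infix 6 _∶_
data Fm : Set where
  atom : ℕ → Fm
  falsum : Fm
  _⇒_ : Fm → Fm → Fm
  _∶_ : Term → Fm → Fm

¬F : Fm → Fm
¬F A = A ⇒ falsum

_∨F_ : Fm → Fm → Fm
A ∨F B = ¬F A ⇒ B

-- A logic L^A : (cl),(j),(j+) plus a chosen subset of {(j4),(jd),(jt)}
record Logic : Set where
  field
    hasJ4 : Bool
    hasJD : Bool
    hasJT : Bool
open Logic public

data ClAxiom : Fm → Set where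
  clK : ∀ A B → ClAxiom (A ⇒ (B ⇒ A))
  clS : ∀ A B C → ClAxiom ((A ⇒ (B ⇒ C)) ⇒ ((A ⇒ B) ⇒ (A ⇒ C)))
  clDN : ∀ A → ClAxiom (¬F (¬F A) ⇒ A)

data Axiom (L : Logic) : Fm → Set where
  cl   : ∀ {A} → ClAxiom A → Axiom L A
  axJ  : ∀ s t A B → Axiom L (s ∶ (A ⇒ B) ⇒ (t ∶ A ⇒ (s · t) ∶ B))
  axJ+ : ∀ s t A → Axiom L (((s ∶ A) ∨F (t ∶ A)) ⇒ (s ⊕ t) ∶ A)
  axJ4 : hasJ4 L ≡ true → ∀ t A → Axiom L (t ∶ A ⇒ (! t) ∶ (t ∶ A))
  axJD : hasJD L ≡ true → ∀ t → Axiom L (t ∶ falsum ⇒ falsum)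
  axJT : hasJT L ≡ true → ∀ t A → Axiom L (t ∶ A ⇒ A)

record ConstSpec (L : Logic) : Set₁ where
  field
    _∋CS_ : ℕ → Fm → Set
    csAxiom : ∀ {c A} → _∋CS_ c A → Axiom L A
open ConstSpec public

bangs : ℕ → Term → Term
bangs zero t = t
bangs (suc n) t = ! (bangs n t)

necFm : ℕ → ℕ → Fm → Fm
necFm zero c A = const c ∶ A
necFm (suc n) c A = bangs (suc n) (const c) ∶ necFm n c A

data _⊢[_]_ (L : Logic) (CS : ConstSpec L) : Fm → Set where
  ax  : ∀ {A} → Axiom L A → L ⊢[ CS ] A
  mp  : ∀ {A B} → L ⊢[ CS ] (A ⇒ B) → L ⊢[ CS ] A → L ⊢[ CS ] B
  nec : ∀ {c A} → _∋CS_ CS c A → (n : ℕ) → L ⊢[ CS ] necFm n c A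

data PFm : Set where
  patom : ℕ → PFm
  pfalsum : PFm
  _⇛_ : PFm → PFm → PFm

embed : PFm → Fm
embed (patom i) = atom i
embed pfalsum = falsum
embed (A ⇛ B) = embed A ⇒ embed B

data CLAxiom : PFm → Set where
  pK : ∀ A B → CLAxiom (A ⇛ (B ⇛ A))
  pS : ∀ A B C → CLAxiom ((A ⇛ (B ⇛ C)) ⇛ ((A ⇛ B) ⇛ (A ⇛ C)))
  pDN : ∀ A → CLAxiom (((A ⇛ pfalsum) ⇛ pfalsum) ⇛ A)

data CL⊢_ : PFm → Set where
  pax : ∀ {A} → CLAxiom A → CL⊢ A
  pmp : ∀ {A B} → CL⊢ (A ⇛ B) → CL⊢ A → CL⊢ B

module Submission where

-- Soundness direction: erasing every justification prefix t : (the forgetful projection)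
-- sends each axiom of L^A to a classical tautology, each necessitated formula to the
-- forgetful projection of an axiom, and commutes with modus ponens; on purely propositional
-- formulas it is the identity. Completeness direction: the axioms of CL are among (cl).

open import Defs
open import Data.Product using (_×_; _,_)
open import Data.List using (List; []; _∷_)
open import Data.List.Membership.Propositional using (_∈_)
open import Data.List.Relation.Unary.Any using (here; there)
open import Data.Nat using (zero; suc)
open import Relation.Binary.PropositionalEquality using (_≡_; refl; sym; cong₂; subst)

forget : Fm → PFm
forget (atom i) = patom i
forget falsum = pfalsum
forget (A ⇒ B) = forget A ⇛ forget B
forget (t ∶ A) = forget A

forget-embed : ∀ F → forget (embed F) ≡ F
forget-embed (patom i) = refl
forget-embed pfalsum = refl
forget-embed (A ⇛ B) = cong₂ _⇛_ (forget-embed A) (forget-embed B)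

forget-necFm : ∀ n c A → forget (necFm n c A) ≡ forget A
forget-necFm zero c A = refl
forget-necFm (suc n) c A = forget-necFm n c A

infix 4 _⊩_

data _⊩_ (Γ : List PFm) : PFm → Set where
  hyp : ∀ {A} → A ∈ Γ → Γ ⊩ A
  hax : ∀ {A} → CLAxiom A → Γ ⊩ A
  hmp : ∀ {A B} → Γ ⊩ (A ⇛ B) → Γ ⊩ A → Γ ⊩ B

⊩-refl : ∀ {Γ} A → Γ ⊩ (A ⇛ A)
⊩-refl A = hmp (hmp (hax (pS A (A ⇛ A) A)) (hax (pK A (A ⇛ A)))) (hax (pK A A))

deduction : ∀ {Γ A B} → (A ∷ Γ) ⊩ B → Γ ⊩ (A ⇛ B)
deduction {A = A} (hyp (here refl)) = ⊩-refl A
deduction {A = A} (hyp {B} (there B∈Γ)) = hmp (hax (pK B A)) (hyp B∈Γ)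
deduction {A = A} (hax {B} axB) = hmp (hax (pK B A)) (hax axB)
deduction {A = A} (hmp {C} {B} d e) = hmp (hmp (hax (pS A C B)) (deduction d)) (deduction e)

⊩⇒CL⊢ : ∀ {A} → [] ⊩ A → CL⊢ A
⊩⇒CL⊢ (hax axA) = pax axA
⊩⇒CL⊢ (hmp d e) = pmp (⊩⇒CL⊢ d) (⊩⇒CL⊢ e)

CL⊢-refl : ∀ A → CL⊢ (A ⇛ A)
CL⊢-refl A = ⊩⇒CL⊢ (⊩-refl A)

CL⊢-consequentia-mirabilis : ∀ A → CL⊢ (((A ⇛ pfalsum) ⇛ A) ⇛ A)
CL⊢-consequentia-mirabilis A = ⊩⇒CL⊢ (deduction (hmp (hax (pDN A)) (deduction
  (hmp (hyp (here refl)) (hmp (hyp (there (here refl))) (hyp (here refl)))))))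

forget-axiom : ∀ {L A} → Axiom L A → CL⊢ forget A
forget-axiom (cl (clK A B)) = pax (pK _ _)
forget-axiom (cl (clS A B C)) = pax (pS _ _ _)
forget-axiom (cl (clDN A)) = pax (pDN _)
forget-axiom (axJ s t A B) = CL⊢-refl _
forget-axiom (axJ+ s t A) = CL⊢-consequentia-mirabilis _
forget-axiom (axJ4 _ t A) = CL⊢-refl _
forget-axiom (axJD _ t) = CL⊢-refl _
forget-axiom (axJT _ t A) = CL⊢-refl _

forget-sound : ∀ {L CS A} → L ⊢[ CS ] A → CL⊢ forget A
forget-sound (ax axA) = forget-axiom axA
forget-sound (mp d e) = pmp (forget-sound d) (forget-sound e)
forget-sound {CS = CS} (nec {c} {A} cA n) =
  subst CL⊢_ (sym (forget-necFm n c A)) (forget-axiom (csAxiom CS cA))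

embed-complete : ∀ {L CS F} → CL⊢ F → L ⊢[ CS ] embed F
embed-complete (pax (pK A B)) = ax (cl (clK _ _))
embed-complete (pax (pS A B C)) = ax (cl (clS _ _ _))
embed-complete (pax (pDN A)) = ax (cl (clDN _))
embed-complete (pmp d e) = mp (embed-complete d) (embed-complete e)

mainTheorem8 : (L : Logic) (CS : ConstSpec L) (F : PFm) →
    ((L ⊢[ CS ] embed F) → CL⊢ F) × (CL⊢ F → L ⊢[ CS ] embed F)
mainTheorem8 L CS F = (λ d → subst CL⊢_ (forget-embed F) (forget-sound d)) , embed-complete
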